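{- Let $G=(V,E)$ be a connected graph, $c:V\to\mathbb{N}$, and $\epsilon>0$. The Iterative Rounding algorithm (run SolveIP2$(G,\emptyset,c)$) returns a feasible solution of PDBEP for $(G,c)$, i.e., a set $E'\subseteq E$ such that for every $(u,v)\in E'$, $d'_u\le c_u$ or $d'_v\le c_v$, where $d'_x$ is the degree of $x$ in $(V,E')$.
   Context: For a graph $H=(V_H,E_H)$, $f:V_H\to\{0,1,2,\dots\}$ and $C\subseteq V_H$, LP2$(H,f,C)$ is: maximize $2\sum_{e\in E_H}y_e-(1+\epsilon)\sum_{v\in V_H}z_v$ subject to $\sum_{e\in\delta(v)}y_e\le f_v+z_v$ for $v\in V_H\setminus C$; $\sum_{e\in\delta(v)}y_e\le f_v$ for $v\in C$; $z_v\ge0$; $0\le y_e\le1$ ($\delta(v)$ = edges of $H$ incident on $v$). The recursive procedure SolveIP2$(H,C,f)$: if $E_H=\emptyset$ return $\emptyset$. Delete all isolated vertices from $H$. Compute an optimal extreme point solution $(y,z)$ of LP2$(H,f,C)$. If some $e\in E_H$ has $y_e=0$, return SolveIP2$((V_H,E_H\setminus\{e\}),C,f)$. Otherwise choose an edge $e=(u,v)$ with $y_e\ge 1/2$ and name its endpoints so that $f_v>0$ and $z_v=0$ (such a choice always exists); set $f_v:=f_v-1$, $f_u:=\max\{f_u-1,0\}$, $C:=C\cup\{v\}$, and return SolveIP2$((V_H,E_H\setminus\{e\}),C,f)\cup\{e\}$.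
   Formalization: The parameter ε is a positive rational, and LP2, with its optimal extreme points, is taken over ℚ. -}

module Defs where

open import Data.Nat as ℕ using (ℕ; _∸_)
open import Data.Fin using (Fin; _≟_)
open import Data.Fin.Subset using (Subset; _∈_; _∉_; _∪_; ⁅_⁆)
open import Data.Integer using (+_)
open import Data.Rational as ℚ using (ℚ; 0ℚ; 1ℚ; ½; _≤_; _<_; _+_; _*_; _-_; _/_)
open import Data.List using (List; []; _∷_; length; lookup; removeAt; map; filter; foldr; allFin)
open import Data.List.Membership.Propositional using () renaming (_∈_ to _∈ˡ_)
open import Data.List.Relation.Unary.Any using (Any)
open import Data.Product using (_×_; _,_; proj₁; proj₂; Σ; ∃)
open import Data.Sum using (_⊎_)
open import Relation.Binary.PropositionalEquality using (_≡_; _≢_)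
open import Relation.Nullary using (¬_; Dec; yes; no)
open import Relation.Nullary.Decidable using (_⊎-dec_)

-- Graphs on the vertex set Fin n, edges given as a list of unordered
-- pairs (stored as ordered pairs).

Edge : ℕ → Set
Edge n = Fin n × Fin n

Incident : ∀ {n} → Fin n → Edge n → Set
Incident x (a , b) = (a ≡ x) ⊎ (b ≡ x)

incident? : ∀ {n} (x : Fin n) (e : Edge n) → Dec (Incident x e)
incident? x (a , b) = (a ≟ x) ⊎-dec (b ≟ x)

SameEdge : ∀ {n} → Edge n → Edge n → Set
SameEdge (a , b) e = ((a , b) ≡ e) ⊎ ((b , a) ≡ e)

data SimpleEdges {n : ℕ} : List (Edge n) → Set where
  []  : SimpleEdges []
  _∷_ : ∀ {e es} → (proj₁ e ≢ proj₂ e) × ¬ Any (SameEdge e) es →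
        SimpleEdges es → SimpleEdges (e ∷ es)

data Reach {n : ℕ} (E : List (Edge n)) : Fin n → Fin n → Set where
  here : ∀ {u} → Reach E u u
  step : ∀ {u w v} → Any (SameEdge (u , w)) E → Reach E w v → Reach E u v

Connected : ∀ {n} → List (Edge n) → Set
Connected {n} E = ∀ (u v : Fin n) → Reach E u v

deg : ∀ {n} → List (Edge n) → Fin n → ℕ
deg F x = length (filter (incident? x) F)

PDBEPFeasible : ∀ {n} → List (Edge n) → (Fin n → ℕ) → List (Edge n) → Set
PDBEPFeasible E c F =
  (∀ {e} → e ∈ˡ F → e ∈ˡ E) ×
  (∀ {u v} → (u , v) ∈ˡ F → (deg F u ℕ.≤ c u) ⊎ (deg F v ℕ.≤ c v))

-- LP2(H, f, C) over ℚ.  H is given by its edge list E; its vertex set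
-- (after deleting isolated vertices) is { v | v incident to some edge of E }.

fromℕ : ℕ → ℚ
fromℕ k = + k / 1

Σℚ : ∀ {k} → (Fin k → ℚ) → ℚ
Σℚ {k} g = foldr _+_ 0ℚ (map g (allFin k))

InV : ∀ {n} → List (Edge n) → Fin n → Set
InV E v = Any (Incident v) E

load : ∀ {n} (E : List (Edge n)) → (Fin (length E) → ℚ) → Fin n → ℚ
load E y v = Σℚ (λ i → sel (incident? v (lookup E i)) (y i))
  where
  sel : ∀ {P : Set} → Dec P → ℚ → ℚ
  sel (yes _) q = q
  sel (no _)  q = 0ℚ

Point : ∀ {n} → List (Edge n) → Set
Point {n} E = (Fin (length E) → ℚ) × (Fin n → ℚ)

-- feasibility for LP2(H,f,C); z_v is a variable only for v ∈ V_H,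
-- and is fixed to 0 for vertices not in V_H (they are not variables)
LPFeasible : ∀ {n} (E : List (Edge n)) (C : Subset n) (f : Fin n → ℕ) → Point E → Set
LPFeasible {n} E C f (y , z) =
  (∀ i → (0ℚ ≤ y i) × (y i ≤ 1ℚ)) ×
  (∀ v → InV E v → 0ℚ ≤ z v) ×
  (∀ v → ¬ InV E v → z v ≡ 0ℚ) ×
  (∀ v → InV E v → v ∉ C → load E y v ≤ fromℕ (f v) + z v) ×
  (∀ v → InV E v → v ∈ C → load E y v ≤ fromℕ (f v))

objective : ∀ {n} (ε : ℚ) (E : List (Edge n)) → Point E → ℚ
objective ε E (y , z) = (fromℕ 2 * Σℚ y) - ((1ℚ + ε) * Σℚ z)

Optimal : ∀ {n} (ε : ℚ) (E : List (Edge n)) (C : Subset n) (f : Fin n → ℕ) → Point E → Set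
Optimal ε E C f p =
  LPFeasible E C f p × (∀ q → LPFeasible E C f q → objective ε E q ≤ objective ε E p)

Extreme : ∀ {n} (E : List (Edge n)) (C : Subset n) (f : Fin n → ℕ) → Point E → Set
Extreme E C f (y , z) =
  LPFeasible E C f (y , z) ×
  (∀ y₁ z₁ y₂ z₂ (λ' : ℚ) → 0ℚ < λ' → λ' < 1ℚ →
     LPFeasible E C f (y₁ , z₁) → LPFeasible E C f (y₂ , z₂) →
     (∀ i → y i ≡ λ' * y₁ i + (1ℚ - λ') * y₂ i) →
     (∀ v → z v ≡ λ' * z₁ v + (1ℚ - λ') * z₂ v) →
     (∀ i → y₁ i ≡ y₂ i) × (∀ v → z₁ v ≡ z₂ v))

OptExtreme : ∀ {n} (ε : ℚ) (E : List (Edge n)) (C : Subset n) (f : Fin n → ℕ) → Point E → Set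
OptExtreme ε E C f p = Optimal ε E C f p × Extreme E C f p

-- SolveIP2 as a (nondeterministic) big-step relation:
-- SolveIP2 ε E C f F  means "some run of SolveIP2((V,E),C,f) returns F".

update : ∀ {n} → (Fin n → ℕ) → Fin n → ℕ → Fin n → ℕ
update f v k x with x ≟ v
... | yes _ = k
... | no  _ = f x

data SolveIP2 {n : ℕ} (ε : ℚ) : (E : List (Edge n)) → Subset n → (Fin n → ℕ) → List (Edge n) → Set where
  empty : ∀ {C f} → SolveIP2 ε [] C f []
  dropZero : ∀ {E C f F} (y : Fin (length E) → ℚ) (z : Fin n → ℚ) →
    OptExtreme ε E C f (y , z) →
    (i : Fin (length E)) → y i ≡ 0ℚ →
    SolveIP2 ε (removeAt E i) C f F →
    SolveIP2 ε E C f F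
  round : ∀ {E C f F} (y : Fin (length E) → ℚ) (z : Fin n → ℚ) →
    OptExtreme ε E C f (y , z) →
    (∀ j → y j ≢ 0ℚ) →
    (i : Fin (length E)) → ½ ≤ y i →
    (u v : Fin n) → SameEdge (u , v) (lookup E i) →
    0 ℕ.< f v → z v ≡ 0ℚ →
    SolveIP2 ε (removeAt E i) (C ∪ ⁅ v ⁆)
             (update (update f v (f v ∸ 1)) u (f u ∸ 1)) F →
    SolveIP2 ε E C f (lookup E i ∷ F)

-- We prove by induction on a run of SolveIP2 ε E C f that its output F
-- satisfies the invariant
--   (a) F ⊆ E,
--   (b) every vertex of C has degree at most f in (V,F),
--   (c) every edge of F has an endpoint of degree at most f in (V,F).
-- Deleting an edge with y_e = 0 only shrinks E.  In a rounding step on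
-- e = (u,v), the recursive call sees the capacities f' with f'_v = f_v - 1
-- and f'_u = f_u ∸ 1, and v ∈ C'; adding e raises the degree of u and v
-- by one, which the capacity drop absorbs.  The one delicate case is
-- f_u = 0, where f'_u = f_u gives no room: there either u already has an
-- edge in F, forcing f_u ∸ 1 ≥ 1, or u ∈ C, and then the LP constraint
-- load(u) ≤ f_u = 0 contradicts y_e ≥ ½.  This is the only use of the LP.
module Submission where

open import Defs
open import Data.Nat using (ℕ)
open import Data.Fin using (Fin)
open import Data.Fin.Subset using (⊥)
open import Data.Rational using (ℚ; 0ℚ; _<_)
open import Data.List using (List)

open import Data.Nat as ℕ using (zero; suc; _∸_; z≤n; s≤s)
import Data.Nat.Properties as ℕP
open import Data.Fin as Fin using (_≟_)
open import Data.Fin.Subset using (Subset; _∈_; _∪_; ⁅_⁆)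
open import Data.Fin.Subset.Properties using (x∈⁅x⁆; x∈p∪q⁺)
open import Data.Rational as ℚ using (½)
import Data.Rational.Properties as ℚP
open import Data.List using ([]; _∷_; lookup; removeAt; map; foldr; allFin; length)
open import Data.List.Properties using (filter-accept; filter-reject)
open import Data.List.Membership.Propositional using () renaming (_∈_ to _∈ˡ_)
open import Data.List.Membership.Propositional.Properties using (∈-lookup; ∈-allFin)
open import Data.List.Relation.Unary.Any as Any using (here; there)
open import Data.Product using (_,_; proj₁; proj₂)
open import Data.Sum using (_⊎_; inj₁; inj₂)
open import Data.Empty using (⊥-elim)
open import Relation.Nullary using (¬_; Dec; yes; no)
open import Relation.Binary.PropositionalEquality using (_≡_; _≢_; refl; sym; trans; subst; cong)

≤-+-nonnegʳ : ∀ p {q} → 0ℚ ℚ.≤ q → p ℚ.≤ p ℚ.+ q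
≤-+-nonnegʳ p 0≤q = ℚP.≤-trans (ℚP.≤-reflexive (sym (ℚP.+-identityʳ p))) (ℚP.+-monoʳ-≤ p 0≤q)

≤-+-nonnegˡ : ∀ {p} q → 0ℚ ℚ.≤ p → q ℚ.≤ p ℚ.+ q
≤-+-nonnegˡ q 0≤p = ℚP.≤-trans (ℚP.≤-reflexive (sym (ℚP.+-identityˡ q))) (ℚP.+-monoˡ-≤ q 0≤p)

module NonNegativeSum {A : Set} (g : A → ℚ) (g≥0 : ∀ x → 0ℚ ℚ.≤ g x) where

  sum≥0 : ∀ xs → 0ℚ ℚ.≤ foldr ℚ._+_ 0ℚ (map g xs)
  sum≥0 []       = ℚP.≤-refl
  sum≥0 (x ∷ xs) = ℚP.≤-trans (sum≥0 xs) (≤-+-nonnegˡ _ (g≥0 x))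

  term≤sum : ∀ {x} xs → x ∈ˡ xs → g x ℚ.≤ foldr ℚ._+_ 0ℚ (map g xs)
  term≤sum (x ∷ xs) (here refl) = ≤-+-nonnegʳ (g x) (sum≥0 xs)
  term≤sum (x ∷ xs) (there x∈)  = ℚP.≤-trans (term≤sum xs x∈) (≤-+-nonnegˡ _ (g≥0 x))

-- The contribution of a single edge e carrying value q to the load of u
-- is (q or 0) + 0; we access it through `load` on the one-edge list.
edgeLoad≥0 : ∀ {n} (u : Fin n) (e : Edge n) (q : ℚ) → 0ℚ ℚ.≤ q → 0ℚ ℚ.≤ load (e ∷ []) (λ _ → q) u
edgeLoad≥0 u e q q≥0 with incident? u e
... | yes _ = subst (0ℚ ℚ.≤_) (sym (ℚP.+-identityʳ q)) q≥0
... | no _  = ℚP.≤-refl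

edgeLoad-incident : ∀ {n} (u : Fin n) (e : Edge n) (q : ℚ) → Incident u e →
  load (e ∷ []) (λ _ → q) u ≡ q ℚ.+ 0ℚ
edgeLoad-incident u e q u∈e with incident? u e
... | yes _  = refl
... | no u∉e = ⊥-elim (u∉e u∈e)

edgeValue≤load : ∀ {n} (E : List (Edge n)) (y : Fin (length E) → ℚ) (u : Fin n) (i : Fin (length E)) →
  (∀ j → 0ℚ ℚ.≤ y j) → Incident u (lookup E i) → y i ℚ.≤ load E y u
edgeValue≤load E y u i y≥0 u∈e =
  subst (ℚ._≤ load E y u)
        (trans (sym (ℚP.+-identityʳ _))
               (trans (edgeLoad-incident u (lookup E i) (y i) u∈e) (ℚP.+-identityʳ _)))
        (NonNegativeSum.term≤sum _
          (λ j → subst (0ℚ ℚ.≤_) (ℚP.+-identityʳ _) (edgeLoad≥0 u (lookup E j) (y j) (y≥0 j)))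
          (allFin _) (∈-allFin i))

-- In a feasible point of LP2(H,f,C), an edge with positive value cannot
-- touch a vertex of C of zero capacity: its load would exceed f_u = 0.
LP-capacity-positive : ∀ {n} {E : List (Edge n)} {C : Subset n} {f : Fin n → ℕ} {y z} →
  LPFeasible E C f (y , z) → (i : Fin (length E)) → 0ℚ ℚ.< y i →
  (u : Fin n) → Incident u (lookup E i) → u ∈ C → 0 ℕ.< f u
LP-capacity-positive {E = E} {f = f} {y} feasible i y>0 u u∈e u∈C with f u in fu≡
... | suc _ = s≤s z≤n
... | zero  = ⊥-elim (ℚP.<-irrefl refl (ℚP.<-≤-trans y>0 y≤0))
  where
  u∈V : InV E u
  u∈V = Any.map (λ { refl → u∈e }) (∈-lookup {xs = E} i)

  load≤f : load E y u ℚ.≤ fromℕ (f u)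
  load≤f = proj₂ (proj₂ (proj₂ (proj₂ feasible))) u u∈V u∈C

  y≤0 : y i ℚ.≤ 0ℚ
  y≤0 = ℚP.≤-trans (edgeValue≤load E y u i (λ j → proj₁ (proj₁ feasible j)) u∈e)
                   (subst (λ k → load E y u ℚ.≤ fromℕ k) fu≡ load≤f)

deg-incident : ∀ {n} {w : Fin n} {e} F → Incident w e → deg (e ∷ F) w ≡ suc (deg F w)
deg-incident {w = w} F w∈e = cong length (filter-accept (incident? w) w∈e)

deg-nonincident : ∀ {n} {w : Fin n} {e} F → ¬ Incident w e → deg (e ∷ F) w ≡ deg F w
deg-nonincident {w = w} F w∉e = cong length (filter-reject (incident? w) w∉e)

deg-positive : ∀ {n} {w : Fin n} {e} {F : List (Edge n)} → Incident w e → e ∈ˡ F → 0 ℕ.< deg F w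
deg-positive {F = _ ∷ F} w∈e (here refl) rewrite deg-incident F w∈e = s≤s z≤n
deg-positive {w = w} {F = x ∷ F} w∈e (there e∈F) with incident? w x
... | yes w∈x rewrite deg-incident F w∈x = s≤s z≤n
... | no w∉x rewrite deg-nonincident F w∉x = deg-positive w∈e e∈F

SameEdge⇒Incidentˡ : ∀ {n} {u v : Fin n} {e} → SameEdge (u , v) e → Incident u e
SameEdge⇒Incidentˡ (inj₁ refl) = inj₁ refl
SameEdge⇒Incidentˡ (inj₂ refl) = inj₂ refl

SameEdge⇒Incidentʳ : ∀ {n} {u v : Fin n} {e} → SameEdge (u , v) e → Incident v e
SameEdge⇒Incidentʳ (inj₁ refl) = inj₂ refl
SameEdge⇒Incidentʳ (inj₂ refl) = inj₁ refl

SameEdge-other : ∀ {n} {u v : Fin n} {e} → SameEdge (u , v) e → ∀ w → w ≢ u → w ≢ v → ¬ Incident w e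
SameEdge-other (inj₁ refl) w w≢u w≢v (inj₁ refl) = w≢u refl
SameEdge-other (inj₁ refl) w w≢u w≢v (inj₂ refl) = w≢v refl
SameEdge-other (inj₂ refl) w w≢u w≢v (inj₁ refl) = w≢v refl
SameEdge-other (inj₂ refl) w w≢u w≢v (inj₂ refl) = w≢u refl

SameEdge-has : ∀ {n} {u} (v : Fin n) {e a b} → SameEdge (u , v) e → (a , b) ≡ e → (a ≡ v) ⊎ (b ≡ v)
SameEdge-has v (inj₁ refl) refl = inj₂ refl
SameEdge-has v (inj₂ refl) refl = inj₁ refl

removeAt-⊆ : ∀ {A : Set} (xs : List A) i {x} → x ∈ˡ removeAt xs i → x ∈ˡ xs
removeAt-⊆ (_ ∷ xs) Fin.zero    x∈         = there x∈
removeAt-⊆ (_ ∷ xs) (Fin.suc i) (here x≡)  = here x≡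
removeAt-⊆ (_ ∷ xs) (Fin.suc i) (there x∈) = there (removeAt-⊆ xs i x∈)

update-same : ∀ {n} (g : Fin n → ℕ) u k → update g u k u ≡ k
update-same g u k with u ≟ u
... | yes _   = refl
... | no u≢u = ⊥-elim (u≢u refl)

update-other : ∀ {n} (g : Fin n → ℕ) u k w → w ≢ u → update g u k w ≡ g w
update-other g u k w w≢u with w ≟ u
... | yes w≡u = ⊥-elim (w≢u w≡u)
... | no _    = refl

roundedCapacity : ∀ {n} → (Fin n → ℕ) → Fin n → Fin n → Fin n → ℕ
roundedCapacity f u v = update (update f v (f v ∸ 1)) u (f u ∸ 1)

-- The capacity of v drops by one, also when u = v.
roundedCapacity-v : ∀ {n} (f : Fin n → ℕ) u v → Dec (v ≡ u) → roundedCapacity f u v v ≡ f v ∸ 1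
roundedCapacity-v f u v (yes refl) = update-same _ v _
roundedCapacity-v f u v (no v≢u)   = trans (update-other _ u _ v v≢u) (update-same f v _)

suc≤ : ∀ {d m} → 0 ℕ.< m → d ℕ.≤ m ∸ 1 → suc d ℕ.≤ m
suc≤ {m = suc m} _ d≤m = s≤s d≤m

module Rounding {n} (f : Fin n → ℕ) (u v : Fin n) where

  f' : Fin n → ℕ
  f' = roundedCapacity f u v

  f'-u : f' u ≡ f u ∸ 1
  f'-u = update-same _ u _

  f'-v : f' v ≡ f v ∸ 1
  f'-v = roundedCapacity-v f u v (v ≟ u)

  f'-other : ∀ w → w ≢ u → w ≢ v → f' w ≡ f w
  f'-other w w≢u w≢v = trans (update-other _ u _ w w≢u) (update-other f v _ w w≢v)

  capacity-u-positive : ∀ {d} → 0 ℕ.< d → d ℕ.≤ f' u → 0 ℕ.< f u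
  capacity-u-positive d>0 d≤f'u with f u | f'-u
  ... | zero  | f'u≡0 = subst (0 ℕ.<_) f'u≡0 (ℕP.≤-trans d>0 d≤f'u)
  ... | suc _ | _     = s≤s z≤n

  degree-restored : ∀ {e} F → SameEdge (u , v) e → 0 ℕ.< f v → ∀ w →
    deg F w ℕ.≤ f' w → (w ≡ u → 0 ℕ.< f u) → deg (e ∷ F) w ℕ.≤ f w
  degree-restored {e} F uv fv>0 w = by-cases (w ≟ v) (w ≟ u)
    where
    -- The decisions are taken as arguments so that `f' w` stays unreduced.
    by-cases : Dec (w ≡ v) → Dec (w ≡ u) →
      deg F w ℕ.≤ f' w → (w ≡ u → 0 ℕ.< f u) → deg (e ∷ F) w ℕ.≤ f w
    by-cases (yes refl) _ d≤ _ rewrite deg-incident F (SameEdge⇒Incidentʳ uv) =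
      suc≤ fv>0 (subst (deg F v ℕ.≤_) f'-v d≤)
    by-cases (no _) (yes refl) d≤ u-ok rewrite deg-incident F (SameEdge⇒Incidentˡ uv) =
      suc≤ (u-ok refl) (subst (deg F u ℕ.≤_) f'-u d≤)
    by-cases (no w≢v) (no w≢u) d≤ _ rewrite deg-nonincident F (SameEdge-other uv w w≢u w≢v) =
      subst (deg F w ℕ.≤_) (f'-other w w≢u w≢v) d≤

record Invariant {n} (E : List (Edge n)) (C : Subset n) (f : Fin n → ℕ) (F : List (Edge n)) : Set where
  field
    ⊆E      : ∀ {e} → e ∈ˡ F → e ∈ˡ E
    C-bound : ∀ x → x ∈ C → deg F x ℕ.≤ f x
    covered : ∀ {a b} → (a , b) ∈ˡ F → (deg F a ℕ.≤ f a) ⊎ (deg F b ℕ.≤ f b)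

-- Besides f_v > 0, the step needs f_u > 0 whenever u ∈ C (from the LP).
invariant-round : ∀ {n} {E : List (Edge n)} {C f F} (i : Fin (length E)) (u v : Fin n) →
  SameEdge (u , v) (lookup E i) → 0 ℕ.< f v → (u ∈ C → 0 ℕ.< f u) →
  Invariant (removeAt E i) (C ∪ ⁅ v ⁆) (roundedCapacity f u v) F →
  Invariant E C f (lookup E i ∷ F)
invariant-round {E = E} {C} {f} {F} i u v uv fv>0 C-ok inv = record
  { ⊆E      = ⊆E′
  ; C-bound = λ x x∈C → restore x (C-bound x (x∈p∪q⁺ (inj₁ x∈C))) (λ { refl → C-ok x∈C })
  ; covered = covered′
  }
  where
  open Invariant inv
  open Rounding f u v

  restore : ∀ w → deg F w ℕ.≤ f' w → (w ≡ u → 0 ℕ.< f u) → deg (lookup E i ∷ F) w ℕ.≤ f w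
  restore = degree-restored F uv fv>0

  ⊆E′ : ∀ {e} → e ∈ˡ (lookup E i ∷ F) → e ∈ˡ E
  ⊆E′ (here refl) = ∈-lookup {xs = E} i
  ⊆E′ (there e∈F) = removeAt-⊆ E i (⊆E e∈F)

  -- v was added to C, so its degree in F is within f_v - 1.
  v-bound : deg (lookup E i ∷ F) v ℕ.≤ f v
  v-bound = restore v (C-bound v (x∈p∪q⁺ (inj₂ (x∈⁅x⁆ v)))) (λ { refl → fv>0 })

  endpoint : ∀ {w e} → Incident w e → e ∈ˡ F → deg F w ℕ.≤ f' w → deg (lookup E i ∷ F) w ℕ.≤ f w
  endpoint w∈e e∈F d≤ = restore _ d≤ (λ { refl → capacity-u-positive (deg-positive w∈e e∈F) d≤ })

  covered′ : ∀ {a b} → (a , b) ∈ˡ (lookup E i ∷ F) →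
    (deg (lookup E i ∷ F) a ℕ.≤ f a) ⊎ (deg (lookup E i ∷ F) b ℕ.≤ f b)
  covered′ (here ab≡e) with SameEdge-has v uv ab≡e
  ... | inj₁ refl = inj₁ v-bound
  ... | inj₂ refl = inj₂ v-bound
  covered′ (there ab∈F) with covered ab∈F
  ... | inj₁ d≤ = inj₁ (endpoint (inj₁ refl) ab∈F d≤)
  ... | inj₂ d≤ = inj₂ (endpoint (inj₂ refl) ab∈F d≤)

invariant : ∀ {n} {ε : ℚ} {E C f F} → SolveIP2 {n} ε E C f F → Invariant E C f F
invariant empty = record { ⊆E = λ () ; C-bound = λ _ _ → z≤n ; covered = λ () }
invariant (dropZero {E = E} _ _ _ i _ run) = record
  { ⊆E = λ e∈F → removeAt-⊆ E i (⊆E e∈F) ; C-bound = C-bound ; covered = covered }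
  where open Invariant (invariant run)
invariant (round {f = f} _ _ ((feasible , _) , _) _ i y≥½ u v uv fv>0 _ run) =
  invariant-round i u v uv fv>0
    (LP-capacity-positive {f = f} feasible i (ℚP.<-≤-trans (ℚP.positive⁻¹ ½) y≥½) u (SameEdge⇒Incidentˡ uv))
    (invariant run)

lemma8 : (n : ℕ) (E : List (Edge n)) → SimpleEdges E → Connected E →
    (c : Fin n → ℕ) (ε : ℚ) → 0ℚ < ε →
    (F : List (Edge n)) → SolveIP2 ε E ⊥ c F →
    PDBEPFeasible E c F
lemma8 n E _ _ c ε _ F run = ⊆E , covered
  where open Invariant (invariant run)
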